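{- Let $A$ be an online algorithm and $B$ an algorithm (online or offline) for the $k$-server problem, and let $n\ge1$. Let $\Phi$ be any potential function, with $\Phi_0$ its value before the first request and $\Phi_i$ its value after $A$ serves $\sigma[i]$, and let $a_i=A(\sigma[i])+\Phi_i-\Phi_{i-1}$ be the amortized cost of $A$ for $\sigma[i]$. Suppose there exist $c,d>0$ and a bijection $\pi:\mathcal{I}_n\to\mathcal{I}_n$ such that for all $\sigma\in\mathcal{I}_n$ and all $i\le n$: (i) $A(\sigma[i]\mid B(\sigma[1,i-1]))\le d\cdot B(\sigma[i])$, and (ii) $a_i\le c\cdot A(\pi(\sigma)[i]\mid B(\pi(\sigma)[1,i-1]))$. Then for all $\sigma\in\mathcal{I}_n$, $A(\sigma)\le c\cdot d\cdot B(\pi(\sigma))+\Phi_0-\Phi_n$.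
   Context: $\mathcal{I}_n$ is the set of all request sequences of length $n$ over the (finite, discretized) metric; $\sigma[i]$ is the $i$-th request and $\sigma[1,i]$ the prefix of length $i$. $A(\sigma)$ is the total cost of $A$ on $\sigma$. $B(\sigma[i])$ (resp. $A(\sigma[i])$) denotes the cost incurred by $B$ (resp. $A$) on the $i$-th request when running on $\sigma$. $A(\sigma[i]\mid B(\sigma[1,i-1]))$ denotes the cost $A$ would incur to serve request $\sigma[i]$ starting from the server configuration that $B$ has after serving $\sigma[1,i-1]$ (if $B$ is offline, its decisions on the prefix are those it makes on the whole sequence). The potential $\Phi$ is a real-valued function of $A$'s state, evaluated along $A$'s run on $\sigma$.
   Formalization: The metric distances, the values of the potential Φ and the constants c and d are rational rather than real. -}

module Defs where

open import Data.Nat using (ℕ; zero; suc)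
open import Data.Fin using (Fin; zero; suc; toℕ; inject₁)
open import Data.List using (List; []; _∷_; _++_; [_]; take)
open import Data.Vec using (Vec; []; _∷_; lookup; toList)
open import Data.Vec.Membership.Propositional using (_∈_)
open import Data.Rational using (ℚ; 0ℚ; _+_; _-_; _*_; _≤_)
open import Relation.Binary.PropositionalEquality using (_≡_)

-- A finite metric space on the points Fin m, with (discretized) rational distances.
record Metric (m : ℕ) : Set where
  field
    dist       : Fin m → Fin m → ℚ
    dist-nonneg : ∀ x y → 0ℚ ≤ dist x y
    dist-zero  : ∀ x y → dist x y ≡ 0ℚ → x ≡ y
    dist-self  : ∀ x → dist x x ≡ 0ℚ
    dist-sym   : ∀ x y → dist x y ≡ dist y x
    dist-tri   : ∀ x y z → dist x z ≤ dist x y + dist y z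
open Metric public

Req : ℕ → Set
Req m = Fin m

Config : ℕ → ℕ → Set
Config m k = Vec (Fin m) k

sumFin : (n : ℕ) → (Fin n → ℚ) → ℚ
sumFin zero    f = 0ℚ
sumFin (suc n) f = f zero + sumFin n (λ i → f (suc i))

sumVec : ∀ {n} → Vec ℚ n → ℚ
sumVec []       = 0ℚ
sumVec (x ∷ xs) = x + sumVec xs

moveCost : ∀ {m k} → Metric m → Config m k → Config m k → ℚ
moveCost M []       []        = 0ℚ
moveCost M (x ∷ xs) (y ∷ ys) = dist M x y + moveCost M xs ys

record OnlineAlg (m k : ℕ) : Set where
  field
    init  : Config m k
    step  : List (Req m) → Config m k → Req m → Config m k
    serve : ∀ h C r → r ∈ step h C r
open OnlineAlg public

-- An arbitrary (possibly offline) algorithm for sequences of length n: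
-- it sees the whole sequence and outputs its configurations
-- (index 0 = initial, index i+1 = after serving the (i+1)-th request).
record Alg (m k n : ℕ) : Set where
  field
    run   : Vec (Req m) n → Vec (Config m k) (suc n)
    serve : ∀ σ (i : Fin n) → lookup σ i ∈ lookup (run σ) (suc i)
open Alg public

runFrom : ∀ {m k n} → OnlineAlg m k → List (Req m) → Config m k
        → Vec (Req m) n → Vec (Config m k) n
runFrom A h C []       = []
runFrom A h C (r ∷ rs) = step A h C r ∷ runFrom A (h ++ [ r ]) (step A h C r) rs

runA : ∀ {m k n} → OnlineAlg m k → Vec (Req m) n → Vec (Config m k) (suc n)
runA A σ = init A ∷ runFrom A [] (init A) σ

prefix : ∀ {m n} → Vec (Req m) n → ℕ → List (Req m)
prefix σ j = take j (toList σ)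

-- A(σ[i]) : cost of A on request i (i : Fin n is 0-based).
costA-at : ∀ {m k n} → Metric m → OnlineAlg m k → Vec (Req m) n → Fin n → ℚ
costA-at M A σ i = moveCost M (lookup (runA A σ) (inject₁ i)) (lookup (runA A σ) (suc i))

costB-at : ∀ {m k n} → Metric m → Alg m k n → Vec (Req m) n → Fin n → ℚ
costB-at M B σ i = moveCost M (lookup (run B σ) (inject₁ i)) (lookup (run B σ) (suc i))

costA : ∀ {m k n} → Metric m → OnlineAlg m k → Vec (Req m) n → ℚ
costA {n = n} M A σ = sumFin n (costA-at M A σ)

costB : ∀ {m k n} → Metric m → Alg m k n → Vec (Req m) n → ℚ
costB {n = n} M B σ = sumFin n (costB-at M B σ)

-- A(σ[i] | B(σ[1,i-1])): cost A incurs serving σ[i] (with history σ[1,i-1])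
-- when starting from the configuration B has after serving σ[1,i-1].
costA-given-B : ∀ {m k n} → Metric m → OnlineAlg m k → Alg m k n
              → Vec (Req m) n → Fin n → ℚ
costA-given-B M A B σ i =
  let C = lookup (run B σ) (inject₁ i) in
  moveCost M C (step A (prefix σ (toℕ i)) C (lookup σ i))

Potential : ℕ → ℕ → Set
Potential m k = List (Req m) → Config m k → ℚ

Φ-at : ∀ {m k n} → OnlineAlg m k → Potential m k → Vec (Req m) n → Fin (suc n) → ℚ
Φ-at A Φ σ j = Φ (prefix σ (toℕ j)) (lookup (runA A σ) j)

amortized : ∀ {m k n} → Metric m → OnlineAlg m k → Potential m k
          → Vec (Req m) n → Fin n → ℚ
amortized M A Φ σ i = costA-at M A σ i + Φ-at A Φ σ (suc i) - Φ-at A Φ σ (inject₁ i)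

-- Summing the amortized costs along σ telescopes the potential, so
-- A(σ) + Φ_n − Φ_0 = Σ a_i. Hypothesis (ii) bounds this by c Σ A(π(σ)[i] | B(π(σ)[1,i−1])),
-- and hypothesis (i), applied to the sequence π(σ), bounds that sum by d B(π(σ)).
module Submission where

open import Defs
open import Data.Nat using (ℕ; suc; zero)
open import Data.Fin using (Fin; zero; suc; fromℕ; inject₁)
open import Data.Vec using (Vec)
open import Data.Rational using (ℚ; 0ℚ; _+_; _-_; -_; _*_; _≤_; _<_; NonNegative; nonNegative)
open import Data.Rational.Properties
  using (+-assoc; *-assoc; +-inverseʳ; *-zeroʳ; *-distribˡ-+; ≤-refl; <⇒≤;
         +-mono-≤; +-monoˡ-≤; *-monoˡ-≤-nonNeg; module ≤-Reasoning)
open import Data.Rational.Solver using (module +-*-Solver)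
open import Function.Definitions using (Bijective)
open import Relation.Binary.PropositionalEquality using (_≡_; refl; sym; trans; cong; cong₂; module ≡-Reasoning)

open +-*-Solver using (solve; _:+_; :-_; _:=_)

sumFin-cong : ∀ n {f g : Fin n → ℚ} → (∀ i → f i ≡ g i) → sumFin n f ≡ sumFin n g
sumFin-cong zero    f≡g = refl
sumFin-cong (suc n) f≡g = cong₂ _+_ (f≡g zero) (sumFin-cong n (λ i → f≡g (suc i)))

sumFin-mono-≤ : ∀ n {f g : Fin n → ℚ} → (∀ i → f i ≤ g i) → sumFin n f ≤ sumFin n g
sumFin-mono-≤ zero    f≤g = ≤-refl
sumFin-mono-≤ (suc n) f≤g = +-mono-≤ (f≤g zero) (sumFin-mono-≤ n (λ i → f≤g (suc i)))

sumFin-+ : ∀ n (f g : Fin n → ℚ) → sumFin n (λ i → f i + g i) ≡ sumFin n f + sumFin n g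
sumFin-+ zero    f g = refl
sumFin-+ (suc n) f g =
  trans (cong (f zero + g zero +_) (sumFin-+ n (λ i → f (suc i)) (λ i → g (suc i))))
        (interchange (f zero) (g zero) _ _)
  where
  interchange : ∀ a b x y → a + b + (x + y) ≡ (a + x) + (b + y)
  interchange = solve 4 (λ a b x y → a :+ b :+ (x :+ y) := (a :+ x) :+ (b :+ y)) refl

sumFin-*ˡ : ∀ n c (f : Fin n → ℚ) → sumFin n (λ i → c * f i) ≡ c * sumFin n f
sumFin-*ˡ zero    c f = sym (*-zeroʳ c)
sumFin-*ˡ (suc n) c f =
  trans (cong (c * f zero +_) (sumFin-*ˡ n c (λ i → f (suc i))))
        (sym (*-distribˡ-+ c (f zero) _))

sumFin-≤-*ˡ : ∀ n c .{{_ : NonNegative c}} {f g : Fin n → ℚ} →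
              (∀ i → f i ≤ c * g i) → sumFin n f ≤ c * sumFin n g
sumFin-≤-*ˡ n c {f} {g} f≤cg = begin
  sumFin n f                ≤⟨ sumFin-mono-≤ n f≤cg ⟩
  sumFin n (λ i → c * g i)  ≡⟨ sumFin-*ˡ n c g ⟩
  c * sumFin n g            ∎
  where open ≤-Reasoning

sumFin-telescope : ∀ n (f : Fin (suc n) → ℚ) →
                   sumFin n (λ i → f (suc i) - f (inject₁ i)) ≡ f (fromℕ n) - f zero
sumFin-telescope zero    f = sym (+-inverseʳ (f zero))
sumFin-telescope (suc n) f =
  trans (cong (f (suc zero) - f zero +_) (sumFin-telescope n (λ i → f (suc i))))
        (cancel (f (suc zero)) (f zero) (f (fromℕ (suc n))))
  where
  cancel : ∀ a b z → (a - b) + (z - a) ≡ z - b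
  cancel = solve 3 (λ a b z → (a :+ :- b) :+ (z :+ :- a) := z :+ :- b) refl

+-difference-≤⇒≤ : ∀ {a b} x y → a + (x - y) ≤ b → a ≤ b + y - x
+-difference-≤⇒≤ {a} {b} x y a+x-y≤b = begin
  a                      ≡⟨ add-and-cancel a x y ⟩
  a + (x - y) + (y - x)  ≤⟨ +-monoˡ-≤ (y - x) a+x-y≤b ⟩
  b + (y - x)            ≡⟨ sym (+-assoc b y (- x)) ⟩
  b + y - x              ∎
  where
  open ≤-Reasoning
  add-and-cancel : ∀ a x y → a ≡ a + (x - y) + (y - x)
  add-and-cancel = solve 3 (λ a x y → a := a :+ (x :+ :- y) :+ (y :+ :- x)) refl

module _ {m k n} (M : Metric m) (A : OnlineAlg m k) (Φ : Potential m k) (σ : Vec (Req m) n) where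

  sumFin-amortized : sumFin n (amortized M A Φ σ)
                   ≡ costA M A σ + (Φ-at A Φ σ (fromℕ n) - Φ-at A Φ σ zero)
  sumFin-amortized = begin
    sumFin n (amortized M A Φ σ)
      ≡⟨ sumFin-cong n (λ i → +-assoc (costA-at M A σ i) (Φ-at A Φ σ (suc i)) _) ⟩
    sumFin n (λ i → costA-at M A σ i + (Φ-at A Φ σ (suc i) - Φ-at A Φ σ (inject₁ i)))
      ≡⟨ sumFin-+ n (costA-at M A σ) _ ⟩
    costA M A σ + sumFin n (λ i → Φ-at A Φ σ (suc i) - Φ-at A Φ σ (inject₁ i))
      ≡⟨ cong (costA M A σ +_) (sumFin-telescope n (Φ-at A Φ σ)) ⟩
    costA M A σ + (Φ-at A Φ σ (fromℕ n) - Φ-at A Φ σ zero)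
      ∎
    where open ≡-Reasoning

lemma5 : ∀ {m k n : ℕ} → 1 Data.Nat.≤ n → (M : Metric m)
    → (A : OnlineAlg m k) (B : Alg m k n) (Φ : Potential m k)
    → (c d : ℚ) → 0ℚ < c → 0ℚ < d
    → (π : Vec (Req m) n → Vec (Req m) n) → Bijective _≡_ _≡_ π
    → (∀ σ (i : Fin n) → costA-given-B M A B σ i ≤ d * costB-at M B σ i)
    → (∀ σ (i : Fin n) → amortized M A Φ σ i ≤ c * costA-given-B M A B (π σ) i)
    → ∀ σ → costA M A σ ≤ c * d * costB M B (π σ) + Φ-at A Φ σ Fin.zero - Φ-at A Φ σ (fromℕ n)
lemma5 {n = n} _ M A B Φ c d 0<c 0<d π _ A∣B≤dB a≤cA∣B σ =
  +-difference-≤⇒≤ (Φ-at A Φ σ (fromℕ n)) (Φ-at A Φ σ zero) (begin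
    costA M A σ + (Φ-at A Φ σ (fromℕ n) - Φ-at A Φ σ zero)
      ≡⟨ sym (sumFin-amortized M A Φ σ) ⟩
    sumFin n (amortized M A Φ σ)
      ≤⟨ sumFin-≤-*ˡ n c (a≤cA∣B σ) ⟩
    c * sumFin n (costA-given-B M A B (π σ))
      ≤⟨ *-monoˡ-≤-nonNeg c (sumFin-≤-*ˡ n d {{nonNegative (<⇒≤ 0<d)}} (A∣B≤dB (π σ))) ⟩
    c * (d * costB M B (π σ))
      ≡⟨ sym (*-assoc c d _) ⟩
    c * d * costB M B (π σ)
      ∎)
  where
  open ≤-Reasoning
  instance
    c-nonNeg : NonNegative c
    c-nonNeg = nonNegative (<⇒≤ 0<c)
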